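{- Let $P$ be a poset on $[n]$ and $\tau\in\mathfrak{S}^{\pitchfork}(P)$, with cycle partition $\pi$. Then: (a) for each $k\ge1$, the elements of $[n]$ of Level $k$ form an antichain of $P$; (b) every cycle of $\tau$ contains at least one essential element; (c) $\Phi(\tau)$ is a linear extension of $P$.
   Context: $\mathfrak{S}^{\pitchfork}(P)$ is the set of permutations $\tau$ of $[n]$ whose cycle partition $\pi$ is $P$-transverse: each block is an antichain of $P$ and the preposet $P/\pi$ on blocks (transitive closure of $B\le B'$ whenever some $p\in B,q\in B'$ have $p\le_Pq$) is a poset. Levels: a block of $\pi$ has Level 1 if it is minimal in $P/\pi$; for $k\ge 2$, the blocks of Level $k$ are the minimal ones in the poset obtained from $P/\pi$ by removing all blocks of Level less than $k$. An element of $[n]$ has the Level of its block. All Level 1 elements are essential; an element $x$ of Level $k\ge2$ is essential if $x>_Py$ for some $y$ of Level $k-1$. The map $\Phi$: write the cycles of $\tau$ in the following standard form — cycles of lower Level precede cycles of higher Level; each cycle is written starting with its largest (as an integer) essential element; and within each Level the cycles are ordered so that their first elements increase — then $\Phi(\tau)$ is the word $[\sigma_1,\dots,\sigma_n]$ obtained by erasing the parentheses. A linear extension of $P$ is a permutation $[\sigma_1,\dots,\sigma_n]$ such that $i<_Pj$ implies $i$ precedes $j$. -}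

module Defs where

open import Level using (0ℓ)
open import Data.Nat as ℕ using (ℕ; zero; suc)
open import Data.Fin as Fin using (Fin)
open import Data.Fin.Permutation using (Permutation′; _⟨$⟩ʳ_)
open import Data.Product using (Σ; ∃; _×_; _,_; proj₁)
open import Data.Sum using (_⊎_)
open import Data.Empty using (⊥)
open import Data.List using (List; []; _∷_; length; applyUpTo; concatMap; lookup)
open import Data.List.Membership.Propositional using (_∈_)
open import Data.List.Relation.Unary.All using (All)
open import Data.List.Relation.Unary.AllPairs using (AllPairs)
open import Data.List.Relation.Unary.Unique.Propositional using (Unique)
open import Relation.Nullary using (¬_)
open import Relation.Binary using (Rel)
open import Relation.Binary.PropositionalEquality using (_≡_; _≢_)
open import Relation.Binary.Construct.Closure.Transitive using (TransClosure)

iter : ∀ {n} → Permutation′ n → ℕ → Fin n → Fin n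
iter τ zero    x = x
iter τ (suc k) x = τ ⟨$⟩ʳ (iter τ k x)

Strict : ∀ {n} → Rel (Fin n) 0ℓ → Rel (Fin n) 0ℓ
Strict _≤P_ x y = x ≤P y × x ≢ y

module _ {n : ℕ} (_≤P_ : Rel (Fin n) 0ℓ) (τ : Permutation′ n) where

  -- x and y lie in the same cycle of τ (same block of the cycle partition π)
  SameCycle : Rel (Fin n) 0ℓ
  SameCycle x y = ∃ λ k → iter τ k x ≡ y

  -- generating relation of the preposet P/π, read on representatives:
  -- block(x) ≤ block(y) whenever some p ∈ block(x), q ∈ block(y) have p ≤P q
  BlockStep : Rel (Fin n) 0ℓ
  BlockStep x y = Σ (Fin n) λ p → Σ (Fin n) λ q → SameCycle x p × SameCycle y q × p ≤P q

  _≤π_ : Rel (Fin n) 0ℓ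
  _≤π_ = TransClosure BlockStep

  Transverse : Set
  Transverse =
    (∀ x y → SameCycle x y → x ≤P y → x ≡ y)
    × (∀ x y → x ≤π y → y ≤π x → SameCycle x y)

  -- Levels, following the iterative removal of minimal blocks.
  -- Removed k x : the block of x has Level ≤ k (removed in the first k rounds).
  -- LevelSuc k x : the block of x has Level (k+1), i.e. it is not removed yet
  --   and is minimal among the remaining blocks of P/π.
  Removed  : ℕ → Fin n → Set
  LevelSuc : ℕ → Fin n → Set
  Removed zero    x = ⊥
  Removed (suc k) x = Removed k x ⊎ LevelSuc k x
  LevelSuc k x =
    ¬ Removed k x ×
    (∀ y → ¬ Removed k y → y ≤π x → ¬ SameCycle y x → ⊥)

  HasLevel : ℕ → Fin n → Set
  HasLevel zero    x = ⊥
  HasLevel (suc k) x = LevelSuc k x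

  Essential : Fin n → Set
  Essential x =
    HasLevel 1 x ⊎
    (Σ ℕ λ k → HasLevel (suc (suc k)) x ×
       Σ (Fin n) λ y → HasLevel (suc k) y × Strict _≤P_ y x)

  -- a cycle written as (first element , remaining elements)
  CycleWord : Set
  CycleWord = Fin n × List (Fin n)

  word : CycleWord → List (Fin n)
  word (h , t) = h ∷ t

  IsCycleOfτ : CycleWord → Set
  IsCycleOfτ (h , t) =
    (h ∷ t ≡ applyUpTo (λ i → iter τ i h) (suc (length t)))
    × iter τ (suc (length t)) h ≡ h

  StartsAtLargestEssential : CycleWord → Set
  StartsAtLargestEssential (h , t) =
    Essential h × (∀ y → y ∈ h ∷ t → Essential y → y Fin.≤ h)

  Precedes : CycleWord → CycleWord → Set
  Precedes (h , t) (h′ , t′) =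
    ∀ k l → HasLevel k h → HasLevel l h′ →
      k ℕ.< l ⊎ (k ≡ l × h Fin.< h′)

  StandardForm : List CycleWord → Set
  StandardForm cs =
    All IsCycleOfτ cs
    × Unique (concatMap word cs)
    × (∀ x → x ∈ concatMap word cs)
    × All StartsAtLargestEssential cs
    × AllPairs Precedes cs

  -- Φ(τ) = ws means ws is obtained from a standard form by erasing parentheses
  IsΦ : List (Fin n) → Set
  IsΦ ws = Σ (List CycleWord) λ cs → StandardForm cs × ws ≡ concatMap word cs

IsLinearExtension : ∀ {n} → Rel (Fin n) 0ℓ → List (Fin n) → Set
IsLinearExtension {n} _≤P_ ws =
  Unique ws × (∀ x → x ∈ ws) ×
  (∀ x y → Strict _≤P_ x y →
     ∀ (a b : Fin (length ws)) →
       lookup ws a ≡ x → lookup ws b ≡ y → a Fin.< b)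

-- Levels are obtained by repeatedly removing the minimal blocks of the finite poset P/π, which is
-- decidable (Warshall's algorithm), and every element is removed after at most n+1 rounds, since a
-- strictly descending chain of blocks has at most n members.
--
-- (a) If x <P y had the same Level, the block of x would lie strictly below the block of y and survive
-- the same rounds, contradicting the minimality of the block of y.
-- (b) A block of Level k+2 is not minimal once k rounds are done, so a chain of P-relations reaches it
-- from a block surviving round k; the last step p ≤P q of that chain enters the block. Then p lies
-- strictly below the block (so has Level ≤ k+1) and above a block surviving round k (so has Level
-- k+1), which makes q essential.
-- (c) By (b) each cycle has a largest essential element, so the standard form exists. An inversion
-- v <P u with u written before v in Φ(τ) cannot occur inside a cycle, blocks being antichains, nor
-- across cycles, because v <P u forces Level v < Level u while cycles appear by non-decreasing Level.

module Submission where

open import Level using (0ℓ)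
open import Data.Nat as ℕ using (ℕ; zero; suc; _+_; _*_; _∸_; _%_; _/_)
open import Data.Nat.Properties as ℕ using ()
open import Data.Nat.DivMod using (m≡m%n+[m/n]*n; m%n<n)
open import Data.Fin as Fin using (Fin; toℕ; fromℕ<)
open import Data.Fin.Properties as Fin using (any?; all?; pigeonhole; toℕ-fromℕ<; toℕ-inject; ¬∀⟶∃¬-smallest)
open import Data.Fin.Permutation using (Permutation′; _⟨$⟩ʳ_)
open import Data.Product using (Σ; ∃; ∃₂; _×_; _,_; proj₁; proj₂)
open import Data.Sum using (_⊎_; inj₁; inj₂; [_,_]′)
open import Data.Empty using (⊥-elim)
open import Data.List using (List; []; _∷_; length; lookup; map; concatMap; applyUpTo; upTo; allFin; filter)
open import Data.List.Relation.Unary.All as All using (All; []; _∷_)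
import Data.List.Relation.Unary.All.Properties as AllP
open import Data.List.Relation.Unary.AllPairs as AllPairs using (AllPairs; []; _∷_)
import Data.List.Relation.Unary.AllPairs.Properties as APP
open import Data.List.Relation.Unary.Any using (here; there)
open import Data.List.Relation.Unary.Unique.Propositional using (Unique)
import Data.List.Relation.Unary.Unique.Propositional.Properties as Unique
open import Data.List.Membership.Propositional using (_∈_)
open import Data.List.Properties using (length-applyUpTo)
open import Data.List.Membership.Propositional.Properties
  using (∈-lookup; ∈-allFin; ∈-filter⁺; ∈-filter⁻; ∈-applyUpTo⁺; ∈-applyUpTo⁻; ∈-upTo⁺; ∈-map⁺; ∈-map⁻; ∈-concat⁺′; ∈-concat⁻′)
open import Data.List.Relation.Binary.Subset.Propositional using (_⊆_)
open import Data.Vec using (Vec; []; _∷_)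
open import Data.Vec.Relation.Unary.All as VAll using ([]; _∷_)
open import Data.Vec.Relation.Unary.AllPairs as VAllPairs using ([]; _∷_)
import Data.Vec.Relation.Unary.Unique.Propositional.Properties as VUnique
open import Function using (_∘_; id)
open import Function.Bundles using (Injection)
open import Function.Properties.Inverse using (↔⇒↣)
open import Relation.Nullary using (¬_; yes; no)
open import Relation.Nullary.Decidable using (_×-dec_; _⊎-dec_; _→-dec_; ¬?; map′; decidable-stable)
open import Relation.Unary using (Pred) renaming (Decidable to Decidable₁)
open import Relation.Binary using (Rel; Decidable; IsDecPartialOrder; tri<; tri≈; tri>)
open import Relation.Binary.PropositionalEquality
open import Relation.Binary.Construct.Closure.Transitive using (TransClosure; [_]; _∷_; _++_)

open import Defs hiding (Removed; LevelSuc)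
import Defs as D

module _ {n ℓ} {R : Rel (Fin n) ℓ} (R? : Decidable R) where

  -- Warshall: Via vs x y are the R-paths from x to y all of whose intermediate vertices lie in vs.
  data Via (vs : List (Fin n)) : Rel (Fin n) ℓ where
    step    : ∀ {x y} → R x y → Via vs x y
    through : ∀ {x z y} → Via vs x z → z ∈ vs → Via vs z y → Via vs x y

  Via-mono : ∀ {vs ws} → vs ⊆ ws → ∀ {x y} → Via vs x y → Via ws x y
  Via-mono vs⊆ws (step r)          = step r
  Via-mono vs⊆ws (through p z∈ q) = through (Via-mono vs⊆ws p) (vs⊆ws z∈) (Via-mono vs⊆ws q)

  Via-split : ∀ {w vs x y} → Via (w ∷ vs) x y → Via vs x y ⊎ (Via vs x w × Via vs w y)
  Via-split (step r) = inj₁ (step r)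
  Via-split (through p (here refl) q) =
    inj₂ ([ id , proj₁ ]′ (Via-split p) , [ id , proj₂ ]′ (Via-split q))
  Via-split (through p (there z∈) q) with Via-split p | Via-split q
  ... | inj₁ p′         | inj₁ q′         = inj₁ (through p′ z∈ q′)
  ... | inj₁ p′         | inj₂ (q₁ , q₂)  = inj₂ (through p′ z∈ q₁ , q₂)
  ... | inj₂ (p₁ , p₂)  | inj₁ q′         = inj₂ (p₁ , through p₂ z∈ q′)
  ... | inj₂ (p₁ , _)   | inj₂ (_ , q₂)   = inj₂ (p₁ , q₂)

  Via? : ∀ vs → Decidable (Via vs)
  Via? [] x y = map′ step (λ { (step r) → r ; (through _ () _) }) (R? x y)
  Via? (w ∷ vs) x y =
    map′ join Via-split (Via? vs x y ⊎-dec (Via? vs x w ×-dec Via? vs w y))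
    where
    join : Via vs x y ⊎ (Via vs x w × Via vs w y) → Via (w ∷ vs) x y
    join (inj₁ p)       = Via-mono there p
    join (inj₂ (p , q)) = through (Via-mono there p) (here refl) (Via-mono there q)

  Via⇒TransClosure : ∀ {vs x y} → Via vs x y → TransClosure R x y
  Via⇒TransClosure (step r)         = [ r ]
  Via⇒TransClosure (through p _ q) = Via⇒TransClosure p ++ Via⇒TransClosure q

  TransClosure⇒Via : ∀ {x y} → TransClosure R x y → Via (allFin n) x y
  TransClosure⇒Via [ r ]              = step r
  TransClosure⇒Via (_∷_ {y = z} r rs) = through (step r) (∈-allFin z) (TransClosure⇒Via rs)

  TransClosure? : Decidable (TransClosure R)
  TransClosure? x y = map′ Via⇒TransClosure TransClosure⇒Via (Via? (allFin n) x y)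

module _ {n p} {P : Pred (Fin n) p} (P? : Decidable₁ P) where

  open import Data.List.Extrema (Fin.≤-totalOrder n) using (max; argmax-all; xs≤max)

  greatest : ∃ P → ∃ λ y → P y × (∀ z → P z → z Fin.≤ y)
  greatest (w , pw) =
    max w candidates ,
    argmax-all id pw (AllP.all-filter P? (allFin n)) ,
    λ z pz → All.lookup (xs≤max w candidates) (∈-filter⁺ P? (∈-allFin z) pz)
    where
    candidates : List (Fin n)
    candidates = filter P? (allFin n)

module _ {a r} {A : Set a} {R : Rel A r} where

  AllPairs-lookup : ∀ {xs} → AllPairs R xs →
                    ∀ (i j : Fin (length xs)) → i Fin.< j → R (lookup xs i) (lookup xs j)
  AllPairs-lookup (r ∷ rs) Fin.zero    (Fin.suc j) _         = All.lookup r (∈-lookup j)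
  AllPairs-lookup (r ∷ rs) (Fin.suc i) (Fin.suc j) (ℕ.s≤s i<j) = AllPairs-lookup rs i j i<j

  AllPairs-tabulate∈ : ∀ xs → (∀ {u v} → u ∈ xs → v ∈ xs → R u v) → AllPairs R xs
  AllPairs-tabulate∈ []       f = []
  AllPairs-tabulate∈ (x ∷ xs) f =
    All.tabulate (f (here refl) ∘ there) ∷ AllPairs-tabulate∈ xs (λ u∈ v∈ → f (there u∈) (there v∈))

  AllPairs-mapWithAll : ∀ {p s} {P : Pred A p} {S : Rel A s} →
                        (∀ {x y} → P x → P y → R x y → S x y) →
                        ∀ {xs} → All P xs → AllPairs R xs → AllPairs S xs
  AllPairs-mapWithAll f []         []       = []
  AllPairs-mapWithAll f (px ∷ pxs) (r ∷ rs) =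
    All.zipWith (λ (py , rxy) → f px py rxy) (pxs , r) ∷ AllPairs-mapWithAll f pxs rs

module _ {a r} {A : Set a} {S : Rel A r} where

  lookup-ordered : ∀ {xs} → AllPairs (λ u v → ¬ S v u) xs → ∀ a b →
                   S (lookup xs a) (lookup xs b) → lookup xs a ≢ lookup xs b → a Fin.< b
  lookup-ordered noInversion a b r a≢b with Fin.<-cmp a b
  ... | tri< a<b _ _ = a<b
  ... | tri≈ _ refl _ = ⊥-elim (a≢b refl)
  ... | tri> _ _ b<a = ⊥-elim (AllPairs-lookup noInversion b a b<a r)

module Orbit {n} (τ : Permutation′ n) where

  iter-+ : ∀ a b x → iter τ (a + b) x ≡ iter τ a (iter τ b x)
  iter-+ zero    b x = refl
  iter-+ (suc a) b x = cong (τ ⟨$⟩ʳ_) (iter-+ a b x)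

  iter-injective : ∀ k {x y} → iter τ k x ≡ iter τ k y → x ≡ y
  iter-injective zero    eq = eq
  iter-injective (suc k) eq = iter-injective k (Injection.injective (↔⇒↣ τ) eq)

  iter-repeat : ∀ {i j} x → i ℕ.< j → iter τ i x ≡ iter τ j x →
                ∃ λ d → d ℕ.< j × iter τ (suc d) x ≡ x
  iter-repeat {i} {j} x i<j eq = d , d<j , sym (iter-injective i (begin
    iter τ i x                  ≡⟨ eq ⟩
    iter τ j x                  ≡⟨ cong (λ k → iter τ k x) j≡i+1+d ⟩
    iter τ (i + suc d) x        ≡⟨ iter-+ i (suc d) x ⟩
    iter τ i (iter τ (suc d) x) ∎))
    where
    open ≡-Reasoning
    d : ℕ
    d = j ∸ suc i
    j≡i+1+d : j ≡ i + suc d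
    j≡i+1+d = sym (trans (ℕ.+-suc i d) (ℕ.m+[n∸m]≡n i<j))
    d<j : d ℕ.< j
    d<j = subst (d ℕ.<_) (sym j≡i+1+d) (ℕ.m≤n+m (suc d) i)

  iter-returns : ∀ x → ∃ λ d → d ℕ.< n × iter τ (suc d) x ≡ x
  iter-returns x with i , j , i<j , eq ← pigeonhole (ℕ.n<1+n n) (λ (i : Fin (suc n)) → iter τ (toℕ i) x)
    with d , d<j , ret ← iter-repeat x i<j eq = d , ℕ.<-≤-trans d<j (ℕ.≤-pred (Fin.toℕ<n j)) , ret

  private
    Misses : Fin n → Fin n → Set
    Misses x i = iter τ (suc (toℕ i)) x ≢ x

    ¬alwaysMisses : ∀ x → ¬ (∀ i → Misses x i)
    ¬alwaysMisses x alwaysMisses =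
      let d , d<n , ret = iter-returns x
      in alwaysMisses (fromℕ< d<n) (subst (λ k → iter τ (suc k) x ≡ x) (sym (toℕ-fromℕ< d<n)) ret)

  minimalReturn : ∀ x → ∃ λ m → iter τ (suc m) x ≡ x × (∀ j → j ℕ.< m → iter τ (suc j) x ≢ x)
  minimalReturn x =
    let i , ¬misses , missesBefore =
          ¬∀⟶∃¬-smallest n (Misses x) (λ i → ¬? (iter τ (suc (toℕ i)) x Fin.≟ x)) (¬alwaysMisses x)
    in toℕ i , decidable-stable (_ Fin.≟ _) ¬misses ,
       λ j j<i → subst (λ k → iter τ (suc k) x ≢ x) (trans (toℕ-inject (fromℕ< j<i)) (toℕ-fromℕ< j<i))
                       (missesBefore (fromℕ< j<i))

  lastExponent : Fin n → ℕ
  lastExponent x = proj₁ (minimalReturn x)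

  iter-lastExponent : ∀ x → iter τ (suc (lastExponent x)) x ≡ x
  iter-lastExponent x = proj₁ (proj₂ (minimalReturn x))

  iter-<lastExponent : ∀ x j → j ℕ.< lastExponent x → iter τ (suc j) x ≢ x
  iter-<lastExponent x = proj₂ (proj₂ (minimalReturn x))

  iter-* : ∀ q p x → iter τ p x ≡ x → iter τ (q * p) x ≡ x
  iter-* zero    p x ret = refl
  iter-* (suc q) p x ret = begin
    iter τ (p + q * p) x        ≡⟨ iter-+ p (q * p) x ⟩
    iter τ p (iter τ (q * p) x) ≡⟨ cong (iter τ p) (iter-* q p x ret) ⟩
    iter τ p x                  ≡⟨ ret ⟩
    x                           ∎
    where open ≡-Reasoning

  iter-% : ∀ x k → iter τ k x ≡ iter τ (k % suc (lastExponent x)) x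
  iter-% x k = begin
    iter τ k x                              ≡⟨ cong (λ j → iter τ j x) (m≡m%n+[m/n]*n k p) ⟩
    iter τ (k % p + (k / p) * p) x          ≡⟨ iter-+ (k % p) ((k / p) * p) x ⟩
    iter τ (k % p) (iter τ ((k / p) * p) x) ≡⟨ cong (iter τ (k % p)) (iter-* (k / p) p x (iter-lastExponent x)) ⟩
    iter τ (k % p) x                        ∎
    where
    open ≡-Reasoning
    p : ℕ
    p = suc (lastExponent x)

  _∼_ : Rel (Fin n) 0ℓ
  x ∼ y = ∃ λ k → iter τ k x ≡ y

  ∼-bounded : ∀ {x y} → x ∼ y → ∃ λ i → i ℕ.< suc (lastExponent x) × iter τ i x ≡ y
  ∼-bounded {x} (k , refl) = k % suc (lastExponent x) , m%n<n k (suc (lastExponent x)) , sym (iter-% x k)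

  ∼-refl : ∀ {x} → x ∼ x
  ∼-refl = 0 , refl

  ∼-trans : ∀ {x y z} → x ∼ y → y ∼ z → x ∼ z
  ∼-trans {x} (i , refl) (j , refl) = j + i , iter-+ j i x

  ∼-sym : ∀ {x y} → x ∼ y → y ∼ x
  ∼-sym {x} x∼y with i , i<p , refl ← ∼-bounded x∼y = p ∸ i , (begin
    iter τ (p ∸ i) (iter τ i x)   ≡⟨ iter-+ (p ∸ i) i x ⟨
    iter τ (p ∸ i + i) x          ≡⟨ cong (λ k → iter τ k x) (ℕ.m∸n+n≡m (ℕ.<⇒≤ i<p)) ⟩
    iter τ p x                    ≡⟨ iter-lastExponent x ⟩
    x                             ∎)
    where
    open ≡-Reasoning
    p : ℕ
    p = suc (lastExponent x)

  opaque
    _∼?_ : Decidable _∼_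
    x ∼? y = map′ (λ (i , e) → toℕ i , e) fromBounded
                  (any? λ (i : Fin (suc (lastExponent x))) → iter τ (toℕ i) x Fin.≟ y)
      where
      fromBounded : x ∼ y → ∃ λ (i : Fin (suc (lastExponent x))) → iter τ (toℕ i) x ≡ y
      fromBounded x∼y =
        let i , i<p , e = ∼-bounded x∼y
        in fromℕ< i<p , trans (cong (λ k → iter τ k x) (toℕ-fromℕ< i<p)) e

module Transversal {n} (_≤P_ : Rel (Fin n) 0ℓ) (isDPO : IsDecPartialOrder _≡_ _≤P_)
                   (τ : Permutation′ n) (transverse : Transverse _≤P_ τ) where

  open Orbit τ
  open IsDecPartialOrder isDPO using (_≤?_) renaming (refl to ≤P-refl)

  blocks-antichain : ∀ {x y} → x ∼ y → x ≤P y → x ≡ y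
  blocks-antichain = proj₁ transverse _ _

  _≼_ : Rel (Fin n) 0ℓ
  _≼_ = _≤π_ _≤P_ τ

  ≼-antisym : ∀ {x y} → x ≼ y → y ≼ x → x ∼ y
  ≼-antisym = proj₂ transverse _ _

  opaque
    _≼?_ : Decidable _≼_
    _≼?_ = TransClosure? λ x y → any? λ p → any? λ q → x ∼? p ×-dec y ∼? q ×-dec p ≤? q

  ≤P⇒≼ : ∀ {x y} → x ≤P y → x ≼ y
  ≤P⇒≼ {x} {y} x≤y = [ x , y , ∼-refl , ∼-refl , x≤y ]

  ∼⇒≼ : ∀ {x y} → x ∼ y → x ≼ y
  ∼⇒≼ {x} x∼y = [ x , x , ∼-refl , ∼-sym x∼y , ≤P-refl ]

  _≺_ : Rel (Fin n) 0ℓ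
  x ≺ y = x ≼ y × ¬ x ∼ y

  ≺-irrefl : ∀ {x} → ¬ x ≺ x
  ≺-irrefl (_ , ¬x∼x) = ¬x∼x ∼-refl

  ≺-trans : ∀ {x y z} → x ≺ y → y ≺ z → x ≺ z
  ≺-trans (x≼y , ¬x∼y) (y≼z , _) =
    x≼y ++ y≼z , λ x∼z → ¬x∼y (≼-antisym x≼y (y≼z ++ ∼⇒≼ (∼-sym x∼z)))

  ≺-respʳ-∼ : ∀ {x y z} → x ≺ y → y ∼ z → x ≺ z
  ≺-respʳ-∼ (x≼y , ¬x∼y) y∼z = x≼y ++ ∼⇒≼ y∼z , λ x∼z → ¬x∼y (∼-trans x∼z (∼-sym y∼z))

  <P⇒≺ : ∀ {x y} → Strict _≤P_ x y → x ≺ y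
  <P⇒≺ (x≤y , x≢y) = ≤P⇒≼ x≤y , λ x∼y → x≢y (blocks-antichain x∼y x≤y)

  private
    entryAt : ∀ {x y z} → BlockStep _≤P_ τ y z → ¬ y ∼ x → z ∼ x →
              ∃₂ λ p q → y ≼ p × ¬ p ∼ x × p ≤P q × q ∼ x
    entryAt (p , q , y∼p , z∼q , p≤q) ¬y∼x z∼x =
      p , q , ∼⇒≼ y∼p , (λ p∼x → ¬y∼x (∼-trans y∼p p∼x)) , p≤q , ∼-trans (∼-sym z∼q) z∼x

  ≺-entry : ∀ {x y} → y ≼ x → ¬ y ∼ x → ∃₂ λ p q → y ≼ p × ¬ p ∼ x × p ≤P q × q ∼ x
  ≺-entry [ y→x ] ¬y∼x = entryAt y→x ¬y∼x ∼-refl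
  ≺-entry {x} (_∷_ {y = z} y→z z≼x) ¬y∼x with z ∼? x
  ... | yes z∼x = entryAt y→z ¬y∼x z∼x
  ... | no ¬z∼x = let p , q , z≼p , rest = ≺-entry z≼x ¬z∼x in p , q , y→z ∷ z≼p , rest

  Removed : ℕ → Fin n → Set
  Removed = D.Removed _≤P_ τ

  LevelSuc : ℕ → Fin n → Set
  LevelSuc = D.LevelSuc _≤P_ τ

  opaque
    Removed?  : ∀ k → Decidable₁ (Removed k)
    LevelSuc? : ∀ k → Decidable₁ (LevelSuc k)
    Removed? zero    x = no λ ()
    Removed? (suc k) x = Removed? k x ⊎-dec LevelSuc? k x
    LevelSuc? k x =
      ¬? (Removed? k x) ×-dec all? λ y → ¬? (Removed? k y) →-dec y ≼? x →-dec ¬? (¬? (y ∼? x))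

  LevelSuc-minimal : ∀ {k x y} → LevelSuc k x → ¬ Removed k y → ¬ y ≺ x
  LevelSuc-minimal (_ , minimal) ¬ry (y≼x , ¬y∼x) = minimal _ ¬ry y≼x ¬y∼x

  Removed-≼   : ∀ k {x y} → Removed k y → x ≼ y → Removed k x
  LevelSuc-∼ : ∀ k {x y} → x ∼ y → LevelSuc k x → LevelSuc k y

  Removed-≼ (suc k) (inj₁ ry) x≼y = inj₁ (Removed-≼ k ry x≼y)
  Removed-≼ (suc k) {x} {y} (inj₂ ly) x≼y with Removed? k x | x ∼? y
  ... | yes rx  | _        = inj₁ rx
  ... | no ¬rx  | yes x∼y  = inj₂ (LevelSuc-∼ k (∼-sym x∼y) ly)
  ... | no ¬rx  | no ¬x∼y  = ⊥-elim (LevelSuc-minimal ly ¬rx (x≼y , ¬x∼y))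

  LevelSuc-∼ k x∼y (¬rx , minimal) =
    (λ ry → ¬rx (Removed-≼ k ry (∼⇒≼ x∼y))) ,
    λ z ¬rz z≼y ¬z∼y → minimal z ¬rz (z≼y ++ ∼⇒≼ (∼-sym x∼y)) (λ z∼x → ¬z∼y (∼-trans z∼x x∼y))

  Removed-mono : ∀ {k l x} → k ℕ.≤ l → Removed k x → Removed l x
  Removed-mono {k} {l} k≤l rx with ℕ.m≤n⇒m<n∨m≡n k≤l
  ... | inj₂ refl = rx
  Removed-mono {l = suc l} _ rx | inj₁ k<1+l = inj₁ (Removed-mono (ℕ.≤-pred k<1+l) rx)

  LevelSuc-unique : ∀ {k l x} → LevelSuc k x → LevelSuc l x → k ≡ l
  LevelSuc-unique {k} {l} lk ll with ℕ.<-cmp k l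
  ... | tri< k<l _ _ = ⊥-elim (proj₁ ll (Removed-mono k<l (inj₂ lk)))
  ... | tri≈ _ k≡l _ = k≡l
  ... | tri> _ _ l<k = ⊥-elim (proj₁ lk (Removed-mono l<k (inj₂ ll)))

  LevelSuc-≺ : ∀ {l x y} → LevelSuc l x → y ≺ x → Removed l y
  LevelSuc-≺ {l} {y = y} lx y≺x with Removed? l y
  ... | yes ry = ry
  ... | no ¬ry = ⊥-elim (LevelSuc-minimal lx ¬ry y≺x)

  Removed⇒LevelSuc : ∀ {l x} → Removed l x → ∃ λ k → k ℕ.< l × LevelSuc k x
  Removed⇒LevelSuc {suc l} (inj₁ rx) =
    let k , k<l , lk = Removed⇒LevelSuc rx in k , ℕ.m<n⇒m<1+n k<l , lk
  Removed⇒LevelSuc {suc l} (inj₂ lx) = l , ℕ.n<1+n l , lx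

  ¬Removed⇒≺ : ∀ {k x} → ¬ Removed (suc k) x → ∃ λ y → ¬ Removed k y × y ≺ x
  ¬Removed⇒≺ {k} {x} ¬rx with any? (λ y → ¬? (Removed? k y) ×-dec y ≼? x ×-dec ¬? (y ∼? x))
  ... | yes (y , ¬ry , y≼x , ¬y∼x) = y , ¬ry , y≼x , ¬y∼x
  ... | no ∄y = ⊥-elim (¬rx (inj₂ ((¬rx ∘ inj₁) , λ y ¬ry y≼x ¬y∼x → ∄y (y , ¬ry , y≼x , ¬y∼x))))

  descendingChain : ∀ k {x} → ¬ Removed k x →
                    Σ (Vec (Fin n) k) λ ys → VAll.All (_≺ x) ys × VAllPairs.AllPairs (λ a b → b ≺ a) ys
  descendingChain zero    _   = [] , [] , []
  descendingChain (suc k) ¬rx =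
    let y , ¬ry , y≺x = ¬Removed⇒≺ ¬rx
        ys , ys≺y , descending = descendingChain k ¬ry
    in y ∷ ys , y≺x ∷ VAll.map (λ z≺y → ≺-trans z≺y y≺x) ys≺y , ys≺y ∷ descending

  Removed-suc-n : ∀ x → Removed (suc n) x
  Removed-suc-n x with Removed? (suc n) x
  ... | yes r  = r
  ... | no ¬r  =
    let ys , _ , descending = descendingChain (suc n) ¬r
        distinct = VAllPairs.map (λ b≺a a≡b → ≺-irrefl (subst (_ ≺_) a≡b b≺a)) descending
    in ⊥-elim (ℕ.n≮n n (Fin.injective⇒≤ (VUnique.lookup-injective distinct _ _)))

  level : Fin n → ℕ
  level x = proj₁ (Removed⇒LevelSuc (Removed-suc-n x))

  level-≤n : ∀ x → level x ℕ.≤ n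
  level-≤n x = ℕ.≤-pred (proj₁ (proj₂ (Removed⇒LevelSuc (Removed-suc-n x))))

  LevelSuc-level : ∀ x → LevelSuc (level x) x
  LevelSuc-level x = proj₂ (proj₂ (Removed⇒LevelSuc (Removed-suc-n x)))

  LevelSuc⇒level : ∀ {k x} → LevelSuc k x → level x ≡ k
  LevelSuc⇒level = LevelSuc-unique (LevelSuc-level _)

  level-∼ : ∀ {x y} → x ∼ y → level x ≡ level y
  level-∼ x∼y = sym (LevelSuc⇒level (LevelSuc-∼ _ x∼y (LevelSuc-level _)))

  ≺⇒level< : ∀ {x y} → y ≺ x → level y ℕ.< level x
  ≺⇒level< y≺x =
    let k , k<l , lk = Removed⇒LevelSuc (LevelSuc-≺ (LevelSuc-level _) y≺x)
    in subst (ℕ._< _) (sym (LevelSuc⇒level lk)) k<l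

  levels-antichain : ∀ k x y → HasLevel _≤P_ τ k x → HasLevel _≤P_ τ k y → x ≤P y → x ≡ y
  levels-antichain (suc k) x y (¬rx , _) ly x≤y with x Fin.≟ y
  ... | yes x≡y = x≡y
  ... | no x≢y  = ⊥-elim (LevelSuc-minimal ly ¬rx (<P⇒≺ (x≤y , x≢y)))

  LevelSuc-suc⇒above-LevelSuc : ∀ {k x} → LevelSuc (suc k) x →
                                ∃₂ λ p q → LevelSuc k p × Strict _≤P_ p q × q ∼ x
  LevelSuc-suc⇒above-LevelSuc {k} {x} lx@(¬rx , _) =
    let y , ¬ry , y≼x , ¬y∼x = ¬Removed⇒≺ ¬rx
        p , q , y≼p , ¬p∼x , p≤q , q∼x = ≺-entry y≼x ¬y∼x
        p≺x = ≺-respʳ-∼ (≤P⇒≼ p≤q , λ p∼q → ¬p∼x (∼-trans p∼q q∼x)) q∼x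
        lp = [ (λ rp → ⊥-elim (¬ry (Removed-≼ k rp y≼p))) , id ]′ (LevelSuc-≺ lx p≺x)
    in p , q , lp , (p≤q , λ p≡q → ¬p∼x (subst (_∼ x) (sym p≡q) q∼x)) , q∼x

  cycle-has-essential : ∀ x → ∃ λ y → x ∼ y × Essential _≤P_ τ y
  cycle-has-essential x with level x | LevelSuc-level x
  ... | zero  | lx = x , ∼-refl , inj₁ lx
  ... | suc k | lx =
    let p , q , lp , p<q , q∼x = LevelSuc-suc⇒above-LevelSuc lx
    in q , ∼-sym q∼x , inj₂ (k , LevelSuc-∼ _ (∼-sym q∼x) lx , p , lp , p<q)

  Essential? : Decidable₁ (Essential _≤P_ τ)
  Essential? x with level x | LevelSuc-level x
  ... | zero  | lx = yes (inj₁ lx)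
  ... | suc k | lx =
    map′ (λ (y , ly , y<x) → inj₂ (k , lx , y , ly , y<x)) fromEssential
         (any? λ y → LevelSuc? k y ×-dec y ≤? x ×-dec ¬? (y Fin.≟ x))
    where
    fromEssential : Essential _≤P_ τ x → ∃ λ y → LevelSuc k y × Strict _≤P_ y x
    fromEssential (inj₁ l0) = ⊥-elim (ℕ.0≢1+n (LevelSuc-unique l0 lx))
    fromEssential (inj₂ (k′ , lx′ , y , ly , y<x)) =
      y , subst (λ j → LevelSuc j y) (ℕ.suc-injective (LevelSuc-unique lx′ lx)) ly , y<x

  private
    greatestEssential : ∀ x → ∃ λ h → (x ∼ h × Essential _≤P_ τ h) ×
                                      (∀ y → x ∼ y × Essential _≤P_ τ y → y Fin.≤ h)
    greatestEssential x = greatest (λ y → x ∼? y ×-dec Essential? y) (cycle-has-essential x)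

  head : Fin n → Fin n
  head x = proj₁ (greatestEssential x)

  ∼-head : ∀ x → x ∼ head x
  ∼-head x = proj₁ (proj₁ (proj₂ (greatestEssential x)))

  head-essential : ∀ x → Essential _≤P_ τ (head x)
  head-essential x = proj₂ (proj₁ (proj₂ (greatestEssential x)))

  head-greatest : ∀ {x y} → x ∼ y → Essential _≤P_ τ y → y Fin.≤ head x
  head-greatest x∼y ey = proj₂ (proj₂ (greatestEssential _)) _ (x∼y , ey)

  head-cong : ∀ {x y} → x ∼ y → head x ≡ head y
  head-cong {x} {y} x∼y = Fin.≤-antisym
    (head-greatest (∼-trans (∼-sym x∼y) (∼-head x)) (head-essential x))
    (head-greatest (∼-trans x∼y (∼-head y)) (head-essential y))

  cycleWord : Fin n → CycleWord _≤P_ τ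
  cycleWord h = h , applyUpTo (λ i → iter τ (suc i) h) (lastExponent h)

  cycleWord-isCycle : ∀ h → IsCycleOfτ _≤P_ τ (cycleWord h)
  cycleWord-isCycle h rewrite length-applyUpTo (λ i → iter τ (suc i) h) (lastExponent h) =
    refl , iter-lastExponent h

  IsCycleOfτ-∈ : ∀ {h t u} → IsCycleOfτ _≤P_ τ (h , t) → u ∈ h ∷ t → h ∼ u
  IsCycleOfτ-∈ {h} {t} {u} (h∷t≡orbit , _) u∈ =
    let i , _ , u≡ = ∈-applyUpTo⁻ (λ i → iter τ i h) (subst (u ∈_) h∷t≡orbit u∈) in i , sym u≡

  ∈-cycleWord : ∀ {h u} → h ∼ u → u ∈ word _≤P_ τ (cycleWord h)
  ∈-cycleWord {h} h∼u =
    let i , i<p , iᵗʰ≡u = ∼-bounded h∼u in subst (_∈ _) iᵗʰ≡u (∈-applyUpTo⁺ (λ i → iter τ i h) i<p)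

  cycleWord-unique : ∀ h → Unique (word _≤P_ τ (cycleWord h))
  cycleWord-unique h = Unique.applyUpTo⁺₁ (λ i → iter τ i h) (suc (lastExponent h)) distinct
    where
    distinct : ∀ {i j} → i ℕ.< j → j ℕ.< suc (lastExponent h) → iter τ i h ≢ iter τ j h
    distinct i<j j<p eq =
      let d , d<j , ret = iter-repeat h i<j eq
      in iter-<lastExponent h d (ℕ.<-≤-trans d<j (ℕ.≤-pred j<p)) ret

  IsHead : Fin n → Set
  IsHead h = head h ≡ h

  IsHead-∼ : ∀ {h h′} → IsHead h → IsHead h′ → h ∼ h′ → h ≡ h′
  IsHead-∼ hh hh′ h∼h′ = trans (sym hh) (trans (head-cong h∼h′) hh′)

  cycleWords-disjoint : ∀ {h h′} → IsHead h → IsHead h′ → h ≢ h′ →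
                        All (λ u → All (u ≢_) (word _≤P_ τ (cycleWord h′))) (word _≤P_ τ (cycleWord h))
  cycleWords-disjoint {h} {h′} hh hh′ h≢h′ = All.tabulate λ u∈ → All.tabulate λ v∈ u≡v →
    h≢h′ (IsHead-∼ hh hh′ (∼-trans (IsCycleOfτ-∈ (cycleWord-isCycle h) u∈)
                                   (∼-sym (subst (h′ ∼_) (sym u≡v) (IsCycleOfτ-∈ (cycleWord-isCycle h′) v∈)))))

  IsHead-startsAtLargestEssential : ∀ {h} → IsHead h → StartsAtLargestEssential _≤P_ τ (cycleWord h)
  IsHead-startsAtLargestEssential {h} hh =
    subst (Essential _≤P_ τ) hh (head-essential h) ,
    λ y y∈ ey → subst (y Fin.≤_) hh (head-greatest (IsCycleOfτ-∈ (cycleWord-isCycle h) y∈) ey)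

  private
    IsHeadAt? : ∀ l → Decidable₁ λ h → IsHead h × level h ≡ l
    IsHeadAt? l h = head h Fin.≟ h ×-dec level h ℕ.≟ l

  headsAt : ℕ → List (Fin n)
  headsAt l = filter (IsHeadAt? l) (allFin n)

  heads : List (Fin n)
  heads = concatMap headsAt (upTo (suc n))

  ∈-heads⁻ : ∀ {h} → h ∈ heads → IsHead h
  ∈-heads⁻ h∈ =
    let hs , h∈hs , hs∈ = ∈-concat⁻′ (map headsAt (upTo (suc n))) h∈
        l , _ , hs≡ = ∈-map⁻ headsAt hs∈
    in proj₁ (proj₂ (∈-filter⁻ (IsHeadAt? l) {xs = allFin n} (subst (_ ∈_) hs≡ h∈hs)))

  ∈-heads⁺ : ∀ {h} → IsHead h → h ∈ heads
  ∈-heads⁺ {h} hh =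
    ∈-concat⁺′ (∈-filter⁺ (IsHeadAt? (level h)) (∈-allFin h) (hh , refl))
               (∈-map⁺ headsAt (∈-upTo⁺ (ℕ.s≤s (level-≤n h))))

  _⊏_ : Rel (Fin n) 0ℓ
  h ⊏ h′ = level h ℕ.< level h′ ⊎ (level h ≡ level h′ × h Fin.< h′)

  ⊏-irrefl : ∀ {h} → ¬ h ⊏ h
  ⊏-irrefl (inj₁ l<l)      = ℕ.<-irrefl refl l<l
  ⊏-irrefl (inj₂ (_ , h<h)) = ℕ.<-irrefl refl h<h

  heads-sorted : AllPairs _⊏_ heads
  heads-sorted = APP.concat⁺ (AllP.map⁺ (All.universal withinLevel _))
                             (APP.map⁺ (APP.applyUpTo⁺₁ id (suc n) acrossLevels))
    where
    levelOf : ∀ {l h} → h ∈ headsAt l → level h ≡ l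
    levelOf {l} h∈ = proj₂ (proj₂ (∈-filter⁻ (IsHeadAt? l) {xs = allFin n} h∈))
    withinLevel : ∀ l → AllPairs _⊏_ (headsAt l)
    withinLevel l =
      AllPairs-mapWithAll (λ h∈ h′∈ h<h′ → inj₂ (trans (levelOf h∈) (sym (levelOf h′∈)) , h<h′))
                          (All.tabulate id) (APP.filter⁺ (IsHeadAt? l) (APP.tabulate⁺-< id))
    acrossLevels : ∀ {l l′} → l ℕ.< l′ → l′ ℕ.< suc n →
                   All (λ h → All (h ⊏_) (headsAt l′)) (headsAt l)
    acrossLevels l<l′ _ = All.tabulate λ h∈ → All.tabulate λ h′∈ →
      inj₁ (subst₂ ℕ._<_ (sym (levelOf h∈)) (sym (levelOf h′∈)) l<l′)

  ⊏⇒Precedes : ∀ {h h′} → h ⊏ h′ → Precedes _≤P_ τ (cycleWord h) (cycleWord h′)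
  ⊏⇒Precedes h⊏h′ (suc k) (suc l) lh lh′
    rewrite sym (LevelSuc⇒level lh) | sym (LevelSuc⇒level lh′) with h⊏h′
  ... | inj₁ lh<lh′        = inj₁ (ℕ.s≤s lh<lh′)
  ... | inj₂ (lh≡lh′ , h<h′) = inj₂ (cong suc lh≡lh′ , h<h′)

  standardForm : List (CycleWord _≤P_ τ)
  standardForm = map cycleWord heads

  standardForm-isStandardForm : StandardForm _≤P_ τ standardForm
  standardForm-isStandardForm =
    AllP.map⁺ (All.universal cycleWord-isCycle heads) ,
    APP.concat⁺ (AllP.map⁺ (AllP.map⁺ (All.universal cycleWord-unique heads)))
                (APP.map⁺ (APP.map⁺ (AllPairs-mapWithAll disjoint (All.tabulate ∈-heads⁻) heads-sorted))) ,
    (λ x → ∈-concat⁺′ (∈-cycleWord (∼-sym (∼-head x)))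
                      (∈-map⁺ (word _≤P_ τ) (∈-map⁺ cycleWord (∈-heads⁺ (sym (head-cong (∼-head x))))))) ,
    AllP.map⁺ (All.tabulate (IsHead-startsAtLargestEssential ∘ ∈-heads⁻)) ,
    APP.map⁺ (AllPairs.map ⊏⇒Precedes heads-sorted)
    where
    disjoint : ∀ {h h′} → IsHead h → IsHead h′ → h ⊏ h′ →
               All (λ u → All (u ≢_) (word _≤P_ τ (cycleWord h′))) (word _≤P_ τ (cycleWord h))
    disjoint hh hh′ h⊏h′ = cycleWords-disjoint hh hh′ λ { refl → ⊏-irrefl h⊏h′ }

  Φ-exists : ∃ λ ws → IsΦ _≤P_ τ ws
  Φ-exists = _ , standardForm , standardForm-isStandardForm , refl

  Precedes⇒level-≤ : ∀ {c c′} → Precedes _≤P_ τ c c′ → level (proj₁ c) ℕ.≤ level (proj₁ c′)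
  Precedes⇒level-≤ {_ , _} {_ , _} precedes with precedes _ _ (LevelSuc-level _) (LevelSuc-level _)
  ... | inj₁ (ℕ.s≤s l<l′)  = ℕ.<⇒≤ l<l′
  ... | inj₂ (l≡l′ , _)    = ℕ.≤-reflexive (ℕ.suc-injective l≡l′)

  standardForm-noInversion : ∀ {cs} → StandardForm _≤P_ τ cs →
                             AllPairs (λ u v → ¬ Strict _≤P_ v u) (concatMap (word _≤P_ τ) cs)
  standardForm-noInversion (cycles , _ , _ , _ , precedes) =
    APP.concat⁺ (AllP.map⁺ (All.map withinCycle cycles))
                (APP.map⁺ (AllPairs-mapWithAll acrossCycles cycles precedes))
    where
    withinCycle : ∀ {c} → IsCycleOfτ _≤P_ τ c → AllPairs (λ u v → ¬ Strict _≤P_ v u) (word _≤P_ τ c)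
    withinCycle {h , t} isCycle = AllPairs-tabulate∈ (h ∷ t) λ u∈ v∈ (v≤u , v≢u) →
      v≢u (blocks-antichain (∼-trans (∼-sym (IsCycleOfτ-∈ isCycle v∈)) (IsCycleOfτ-∈ isCycle u∈)) v≤u)
    acrossCycles : ∀ {c c′} → IsCycleOfτ _≤P_ τ c → IsCycleOfτ _≤P_ τ c′ → Precedes _≤P_ τ c c′ →
                   All (λ u → All (λ v → ¬ Strict _≤P_ v u) (word _≤P_ τ c′)) (word _≤P_ τ c)
    acrossCycles {c@(_ , _)} {c′@(_ , _)} isCycle isCycle′ precedes =
      All.tabulate λ u∈ → All.tabulate λ v∈ v<u →
        ℕ.<⇒≱ (≺⇒level< (<P⇒≺ v<u))
              (subst₂ ℕ._≤_ (level-∼ (IsCycleOfτ-∈ isCycle u∈)) (level-∼ (IsCycleOfτ-∈ isCycle′ v∈))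
                      (Precedes⇒level-≤ {c} {c′} precedes))

  Φ-isLinearExtension : ∀ ws → IsΦ _≤P_ τ ws → IsLinearExtension _≤P_ ws
  Φ-isLinearExtension _ (cs , standard@(_ , unique , complete , _) , refl) = unique , complete , ordered
    where
    ws : List (Fin n)
    ws = concatMap (word _≤P_ τ) cs
    ordered : ∀ x y → Strict _≤P_ x y → ∀ a b → lookup ws a ≡ x → lookup ws b ≡ y → a Fin.< b
    ordered _ _ x<y a b refl refl = lookup-ordered (standardForm-noInversion standard) a b x<y (proj₂ x<y)

lemma3p5 : ∀ {n : ℕ} (_≤P_ : Rel (Fin n) 0ℓ) → IsDecPartialOrder _≡_ _≤P_ →
    (τ : Permutation′ n) → Transverse _≤P_ τ →
    -- (a) the elements of each Level k ≥ 1 form an antichain of P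
    (∀ k x y → HasLevel _≤P_ τ k x → HasLevel _≤P_ τ k y → x ≤P y → x ≡ y)
    -- (b) every cycle of τ contains an essential element
    × (∀ x → Σ (Fin n) λ y → SameCycle _≤P_ τ x y × Essential _≤P_ τ y)
    -- (c) Φ(τ) is well defined and is a linear extension of P
    × (∃ λ ws → IsΦ _≤P_ τ ws)
    × (∀ ws → IsΦ _≤P_ τ ws → IsLinearExtension _≤P_ ws)
lemma3p5 _≤P_ isDPO τ transverse =
  levels-antichain , cycle-has-essential , Φ-exists , Φ-isLinearExtension
  where open Transversal _≤P_ isDPO τ transverse
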